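{- Let $\mathcal G=(V,E)$ be a graph without loops. If $\mathcal G$ is a complete graph or an empty graph, then $\mathcal G$ is quasi-projective (within the class of loopless graphs).
   Context: Graphs are undirected: $E$ is a set of unordered pairs of vertices; here loops are not allowed, so all graphs considered (including the targets $\mathcal T$ below) are loopless. A homomorphism is a map of vertices sending edges to edges; an epimorphism is a surjective homomorphism. A graph $\mathcal S$ is quasi-projective if for every loopless graph $\mathcal T$, every homomorphism $f:\mathcal S\to\mathcal T$ and every epimorphism $j:\mathcal S\to\mathcal T$, there is an endomorphism $\phi$ of $\mathcal S$ with $j\circ\phi=f$. The graph is empty if $E=\emptyset$, and complete if every two distinct vertices are joined by an edge. -}

module Defs where

open import Level using (0ℓ)
open import Data.Product using (Σ; ∃; _,_; _×_)
open import Relation.Nullary using (¬_)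
open import Relation.Binary.PropositionalEquality using (_≡_)
open import Function using (_∘_)

record Graph : Set₁ where
  field
    V   : Set
    E   : V → V → Set
    sym : ∀ {x y} → E x y → E y x
open Graph public

Loopless : Graph → Set
Loopless G = ∀ x → ¬ E G x x

IsHom : (G H : Graph) → (V G → V H) → Set
IsHom G H f = ∀ {x y} → E G x y → E H (f x) (f y)

Surjective : {A B : Set} → (A → B) → Set
Surjective {A} {B} f = ∀ (b : B) → ∃ λ (a : A) → f a ≡ b

IsEpi : (G H : Graph) → (V G → V H) → Set
IsEpi G H f = IsHom G H f × Surjective f

QuasiProjective : Graph → Set₁
QuasiProjective S =
  ∀ (T : Graph) → Loopless T →
  ∀ (f : V S → V T) → IsHom S T f →
  ∀ (j : V S → V T) → IsEpi S T j →
  Σ (V S → V S) λ φ → IsHom S S φ × (∀ x → j (φ x) ≡ f x)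

EmptyGraph : Graph → Set
EmptyGraph G = ∀ x y → ¬ E G x y

CompleteGraph : Graph → Set
CompleteGraph G = ∀ x y → ¬ x ≡ y → E G x y

{-# OPTIONS --safe #-}
module Submission where

open import Defs
open import Data.Sum using (_⊎_; inj₁; inj₂)
open import Data.Product using (Σ; _,_; proj₁; proj₂)
open import Data.Empty using (⊥-elim)
open import Relation.Nullary using (¬_)
open import Relation.Binary.PropositionalEquality
  using (_≡_; trans; cong; subst) renaming (sym to ≡-sym)

-- Lift f through the epimorphism j by choosing, for every x, a j-preimage of f x.
-- Adjacent vertices have adjacent f-images, which differ because the target is
-- loopless, so their chosen preimages differ too; in a complete graph distinct
-- vertices are adjacent, so the lift is an endomorphism.  In an empty graph
-- every map is an endomorphism.

liftThroughSurjection : {A B C : Set} (j : A → B) → Surjective j →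
                        (f : C → B) → Σ (C → A) λ φ → ∀ x → j (φ x) ≡ f x
liftThroughSurjection j j-onto f = (λ x → proj₁ (j-onto (f x))) , (λ x → proj₂ (j-onto (f x)))

empty⇒isHom : (G H : Graph) → EmptyGraph G → (φ : V G → V H) → IsHom G H φ
empty⇒isHom G H empty φ {x} {y} xy = ⊥-elim (empty x y xy)

isHom⇒adjacent-images-≢ : (G T : Graph) → Loopless T → (f : V G → V T) → IsHom G T f →
                          ∀ {x y} → E G x y → ¬ f x ≡ f y
isHom⇒adjacent-images-≢ G T T-loopless f f-hom {x} xy fx≡fy =
  T-loopless (f x) (subst (E T (f x)) (≡-sym fx≡fy) (f-hom xy))

complete⇒lift-isHom : (G H T : Graph) → CompleteGraph H → Loopless T →
                      (f : V G → V T) → IsHom G T f →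
                      (j : V H → V T) (φ : V G → V H) → (∀ x → j (φ x) ≡ f x) →
                      IsHom G H φ
complete⇒lift-isHom G H T complete T-loopless f f-hom j φ jφ≡f {x} {y} xy =
  complete (φ x) (φ y) λ φx≡φy →
    isHom⇒adjacent-images-≢ G T T-loopless f f-hom xy
      (trans (≡-sym (jφ≡f x)) (trans (cong j φx≡φy) (jφ≡f y)))

lemma4p2 : (G : Graph) → Loopless G → CompleteGraph G ⊎ EmptyGraph G → QuasiProjective G
lemma4p2 G _ complete-or-empty T T-loopless f f-hom j (_ , j-onto)
  with liftThroughSurjection j j-onto f
... | φ , jφ≡f = φ , φ-hom complete-or-empty , jφ≡f
  where
  φ-hom : CompleteGraph G ⊎ EmptyGraph G → IsHom G G φ
  φ-hom (inj₁ complete) = complete⇒lift-isHom G G T complete T-loopless f f-hom j φ jφ≡f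
  φ-hom (inj₂ empty)    = empty⇒isHom G G empty φ
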